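{- Let $F\in\mathcal{L}^k_q$ be a $k$-labelled graph and let $m\geq 0$. Then there exists a formula $\varphi_m\in\mathsf{C}^k_q$ such that for every $k$-labelled graph $G$ with $L_F\subseteq L_G$, $G\models\varphi_m$ if and only if $\hom(F,G)=m$.
   Context: A $k$-labelled graph is a finite simple graph $G$ with a partial function $\nu_G\colon[k]\rightharpoonup V(G)$; $L_G$ is the set of labels assigned by $\nu_G$; fully labelled means every vertex has a label. Homomorphisms of labelled graphs preserve edges and labels ($h(\nu_F(\ell))=\nu_G(\ell)$); $\hom$ counts them. Removing a label $\ell$ makes $\nu(\ell)$ undefined; the product of labelled graphs is their disjoint union with equally labelled vertices identified, loops and parallel edges suppressed. A $k$-construction tree for $F$ is a rooted tree $(T,r)$ with $\lambda$ assigning $k$-labelled graphs to nodes: $\lambda(r)=F$, leaves get fully labelled graphs, internal nodes with one child $t'$ (elimination nodes) get $\lambda(t')$ with one label removed, internal nodes with several children get the product of their children's graphs; elimination depth is the max number of elimination nodes on a root-to-leaf path. $\mathcal{L}^k_q$ is the class of $k$-labelled graphs with a $k$-construction tree of elimination depth at most $q$. $\mathsf{C}^k_q$: counting logic (first-order logic over graphs with quantifiers $\exists^{\geq t}$) formulae with at most $k$ distinct variables and quantifier rank at most $q$; variables are $x_1,\dots,x_k$ and a labelled graph $G$ satisfies a formula by interpreting $x_i$ as $\nu_G(i)$. -}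

module Defs where

open import Data.Nat using (ℕ; zero; suc; _≤_; _≤ᵇ_)
open import Data.Fin using (Fin; zero; suc; _≟_)
open import Data.Fin.Properties using () renaming (_≟_ to _≟F_)
open import Data.Bool using (Bool; true; false; not; _∧_; _∨_; if_then_else_)
open import Data.Maybe using (Maybe; just; nothing)
import Data.Maybe as Maybe
open import Data.List using (List; []; _∷_; map; concatMap; filter; length; foldr)
open import Data.List.Base using (allFin)
open import Data.Vec using (Vec; []; _∷_; lookup)
open import Data.Product using (Σ; _×_; _,_; proj₁; proj₂)
open import Relation.Nullary using (¬_; does)
open import Relation.Binary.PropositionalEquality using (_≡_)
open import Relation.Binary.Construct.Closure.ReflexiveTransitive using (Star)

record LGraph (k : ℕ) : Set where
  field
    n      : ℕ
    adj    : Fin n → Fin n → Bool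
    sym    : ∀ u v → adj u v ≡ adj v u
    irrefl : ∀ v → adj v v ≡ false
    ν      : Fin k → Maybe (Fin n)
open LGraph public

IsJust : {A : Set} → Maybe A → Set
IsJust {A} x = Σ A λ a → x ≡ just a

_∈L_ : {k : ℕ} → Fin k → LGraph k → Set
ℓ ∈L G = IsJust (ν G ℓ)

_⊆L_ : {k : ℕ} → LGraph k → LGraph k → Set
F ⊆L G = ∀ ℓ → ℓ ∈L F → ℓ ∈L G

FullyLabelled : {k : ℕ} → LGraph k → Set
FullyLabelled {k} G = ∀ (v : Fin (n G)) → Σ (Fin k) λ ℓ → ν G ℓ ≡ just v

removeLabel : {k : ℕ} → Fin k → LGraph k → LGraph k
removeLabel ℓ G = record
  { n = n G ; adj = adj G ; sym = sym G ; irrefl = irrefl G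
  ; ν = λ ℓ' → if does (ℓ' ≟F ℓ) then nothing else ν G ℓ' }

allMaps : (a b : ℕ) → List (Vec (Fin b) a)
allMaps zero    b = [] ∷ []
allMaps (suc a) b = concatMap (λ x → map (x ∷_) (allMaps a b)) (allFin b)

eqMaybeFin : {m : ℕ} → Maybe (Fin m) → Maybe (Fin m) → Bool
eqMaybeFin nothing  nothing  = true
eqMaybeFin (just x) (just y) = does (x ≟F y)
eqMaybeFin _        _        = false

allB : {A : Set} → (A → Bool) → List A → Bool
allB p = foldr (λ x b → p x ∧ b) true

isHom : {k : ℕ} (F G : LGraph k) → Vec (Fin (n G)) (n F) → Bool
isHom {k} F G h =
  allB (λ u → allB (λ v → not (adj F u v) ∨ adj G (lookup h u) (lookup h v))
                 (allFin (n F))) (allFin (n F))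
  ∧ allB (λ ℓ → labOK (ν F ℓ) (ν G ℓ)) (allFin k)
  where
  labOK : Maybe (Fin (n F)) → Maybe (Fin (n G)) → Bool
  labOK nothing  _  = true
  labOK (just v) w  = eqMaybeFin (just (lookup h v)) w

hom : {k : ℕ} → LGraph k → LGraph k → ℕ
hom F G = length (filter (λ h → isHom F G h ≟B true) (allMaps (n F) (n G)))
  where open import Data.Bool.Properties using () renaming (_≟_ to _≟B_)

-- Graphs presented on an arbitrary vertex type modulo an equivalence
-- (used to describe products, i.e. quotients of disjoint unions), and
-- the statement that a concrete labelled graph G is (isomorphic to) it.

record Pres (k : ℕ) : Set₁ where
  field
    V   : Set
    _≈_ : V → V → Set
    E   : V → V → Set
    lab : Fin k → Maybe V

record Realizes {k : ℕ} (P : Pres k) (G : LGraph k) : Set where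
  open Pres P
  field
    f       : V → Fin (n G)
    resp    : ∀ u v → u ≈ v → f u ≡ f v
    reflect : ∀ u v → f u ≡ f v → u ≈ v
    surj    : ∀ w → Σ V λ u → f u ≡ w
    edge⇒   : ∀ u v → adj G (f u) (f v) ≡ true → E u v
    edge⇐   : ∀ u v → E u v → adj G (f u) (f v) ≡ true
    labels  : ∀ ℓ → ν G ℓ ≡ Maybe.map f (lab ℓ)

toPres : {k : ℕ} → LGraph k → Pres k
toPres H = record { V = Fin (n H) ; _≈_ = _≡_
                  ; E = λ u v → adj H u v ≡ true ; lab = ν H }

_≅_ : {k : ℕ} → LGraph k → LGraph k → Set
G ≅ H = Realizes (toPres H) G

pick : (d : ℕ) {X : Fin d → Set} → ((i : Fin d) → Maybe (X i)) → Maybe (Σ (Fin d) X)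
pick zero    g = nothing
pick (suc d) g with g zero
... | just x  = just (zero , x)
... | nothing = Maybe.map (λ p → suc (proj₁ p) , proj₂ p) (pick d (λ i → g (suc i)))

-- Product of a family Gs of c labelled graphs: disjoint union, with
-- equally labelled vertices identified (equivalence closure), loops and
-- parallel edges suppressed.
module Product {k c : ℕ} (Gs : Fin c → LGraph k) where
  PV : Set
  PV = Σ (Fin c) λ i → Fin (n (Gs i))

  Gen : PV → PV → Set
  Gen (i , a) (j , b) = Σ (Fin k) λ ℓ → (ν (Gs i) ℓ ≡ just a) × (ν (Gs j) ℓ ≡ just b)

  -- Gen is symmetric, so its reflexive-transitive closure is the
  -- generated equivalence relation
  _≈P_ : PV → PV → Set
  _≈P_ = Star Gen

  data ChildEdge : PV → PV → Set where
    ce : ∀ i a b → adj (Gs i) a b ≡ true → ChildEdge (i , a) (i , b)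

  EP : PV → PV → Set
  EP u v = (Σ PV λ u' → Σ PV λ v' → (u ≈P u') × (v ≈P v') × ChildEdge u' v')
           × ¬ (u ≈P v)

  PLab : Fin k → Maybe PV
  PLab ℓ = pick c (λ i → ν (Gs i) ℓ)

  ProductPres : Pres k
  ProductPres = record { V = PV ; _≈_ = _≈P_ ; E = EP ; lab = PLab }

IsProductOf : {k c : ℕ} → LGraph k → (Fin c → LGraph k) → Set
IsProductOf G Gs = Realizes (Product.ProductPres Gs) G

-- k-construction trees of elimination depth at most q.
-- CT q F : F = λ(r) for a construction tree in which every root-to-leaf
-- path has at most q elimination nodes. (Graphs are taken up to ≅.)

data CT {k : ℕ} : ℕ → LGraph k → Set where
  leaf : ∀ {q} {G : LGraph k} → FullyLabelled G → CT q G
  elim : ∀ {q} {G : LGraph k} (G' : LGraph k) (ℓ : Fin k) → ℓ ∈L G' →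
         CT q G' → G ≅ removeLabel ℓ G' → CT (suc q) G
  prod : ∀ {q} {G : LGraph k} (c : ℕ) → 2 ≤ c → (Gs : Fin c → LGraph k) →
         ((i : Fin c) → CT q (Gs i)) → IsProductOf G Gs → CT q G

𝓛 : (k q : ℕ) → LGraph k → Set
𝓛 k q F = CT {k} q F

-- Counting logic C^k_q: variables x_1..x_k (Fin k), quantifier rank ≤ q.

data Form (k : ℕ) : ℕ → Set where
  ⊤f   : ∀ {q} → Form k q
  eq   : ∀ {q} → Fin k → Fin k → Form k q
  E    : ∀ {q} → Fin k → Fin k → Form k q
  ¬f   : ∀ {q} → Form k q → Form k q
  _∧f_ : ∀ {q} → Form k q → Form k q → Form k q
  ∃≥   : ∀ {q} → ℕ → Fin k → Form k q → Form k (suc q)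

C : (k q : ℕ) → Set
C k q = Form k q

count : {A : Set} → (A → Bool) → List A → ℕ
count p xs = length (filter (λ x → p x Data.Bool.Properties.≟ true) xs)
  where import Data.Bool.Properties

-- Evaluation under a partial assignment; atoms mentioning an unassigned
-- variable are false.
sat : {k q : ℕ} (G : LGraph k) → Form k q → (Fin k → Maybe (Fin (n G))) → Bool
sat G ⊤f        α = true
sat G (eq i j)  α with α i | α j
... | just u | just v = does (u ≟F v)
... | _      | _      = false
sat G (E i j)   α with α i | α j
... | just u | just v = adj G u v
... | _      | _      = false
sat G (¬f φ)    α = not (sat G φ α)
sat G (φ ∧f ψ)  α = sat G φ α ∧ sat G ψ α
sat G (∃≥ t i φ) α =
  t ≤ᵇ count (λ v → sat G φ (λ j → if does (j ≟F i) then just v else α j)) (allFin (n G))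

_⊨_ : {k q : ℕ} → LGraph k → Form k q → Set
G ⊨ φ = sat G φ (ν G) ≡ true

-- Induction on the construction tree, for a stronger statement: counts of
-- homomorphisms that need not preserve an edge whose ends carry a pair of
-- labels from a "tolerance" S.  A fully labelled F has at most one homomorphism,
-- forced by the labels, and a quantifier-free formula says whether it exists.
-- Removing label ℓ from F' gives hom(F, G) = Σ_v hom(F', G[ℓ ↦ v]); such a sum
-- equals m iff every summand is at most m and Σ_{j<m} #{v | summand_v > j} = m,
-- and each "#{v | …} = a" costs one counting quantifier over x_ℓ.  A product F of
-- F_1, …, F_c gives hom(F, G) = Π_i hom(F_i, G), a Boolean combination of the
-- factors' formulas.  The tolerance is needed here: an edge of F_i whose ends are
-- identified in F becomes a suppressed loop, so F_i must be allowed to drop it;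
-- F_i inherits tolerance for label pairs naming one vertex or a tolerated edge of F.

module Submission where

open import Data.Nat using (ℕ; zero; suc; _+_; _*_; _∸_; _≤_; _<_; z≤n; s≤s; _≤ᵇ_)
open import Data.Nat.Properties
  using (≤-antisym; ≤-refl; ≤-trans; +-suc; +-assoc; +-identityʳ; *-distribʳ-+; *-zeroʳ;
         m≤m+n; m≤n+m; n≤1+n; m≤n⇒m≤1+n; m≤n⇒m<n∨m≡n; <⇒≱; ≮⇒≥; n≮n; m+[n∸m]≡n; m+n∸m≡n;
         m*n≡0⇒m≡0∨n≡0; n≤0⇒n≡0; m≤m*n; m≤n*m; +-commutativeSemigroup; _≤?_)
  renaming (_≟_ to _≟ℕ_)
open import Algebra.Properties.CommutativeSemigroup +-commutativeSemigroup using () renaming (interchange to +-interchange)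
open import Data.Bool using (Bool; true; false; not; _∧_; _∨_; if_then_else_)
open import Data.Bool.Properties using () renaming (_≟_ to _≟ᵇ_)
open import Data.Fin using (Fin; zero; suc)
open import Data.Fin.Properties using (all?; any?) renaming (_≟_ to _≟F_)
open import Data.Maybe using (Maybe; just; nothing)
import Data.Maybe as Maybe
open import Data.Maybe.Properties using (just-injective) renaming (≡-dec to ≡-decMaybe)
open import Data.Vec using (Vec; []; _∷_; lookup; tabulate)
open import Data.Vec.Properties using (lookup∘tabulate; tabulate∘lookup; tabulate-cong)
open import Data.List using (List; []; _∷_; map; filter; length; _++_; concatMap; cartesianProductWith; cartesianProduct)
open import Data.List.Base using (allFin; downFrom)
open import Data.List.Properties using (length-++; length-map)
open import Data.List.Membership.Propositional using (_∈_)
open import Data.List.Membership.Propositional.Properties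
  using (∈-++⁻; ∈-++⁺ˡ; ∈-++⁺ʳ; ∈-∃++; ∈-map⁻; ∈-filter⁻; ∈-filter⁺;
         ∈-cartesianProductWith⁺; ∈-allFin)
open import Data.List.Relation.Unary.Any using (here; there)
open import Data.List.Relation.Unary.All using (All; []; _∷_) renaming (lookup to All-lookup)
open import Data.List.Relation.Unary.AllPairs using ([]; _∷_)
open import Data.List.Relation.Unary.Unique.Propositional using (Unique)
open import Data.List.Relation.Unary.Unique.Propositional.Properties
  using (filter⁺; cartesianProductWith⁺; cartesianProduct⁺; allFin⁺)
open import Data.Unit using (⊤; tt)
open import Data.Product using (Σ; ∃; _×_; _,_; proj₁; proj₂)
open import Data.Sum using (_⊎_; inj₁; inj₂; [_,_]′)
open import Data.Empty using (⊥-elim)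
open import Function.Base using (case_of_)
open import Function.Bundles using (_⇔_; mk⇔)
open import Relation.Nullary using (¬_; Dec; yes; no; does; ¬?)
open import Relation.Nullary.Decidable using (_×-dec_; _⊎-dec_; _→-dec_; dec-true; dec-false)
open import Relation.Binary.PropositionalEquality
  using (_≡_; refl; sym; trans; cong; cong₂; subst; subst₂; module ≡-Reasoning)
open import Relation.Binary.Construct.Closure.ReflexiveTransitive using (ε; _◅_)
open import Defs hiding (sym)

private
  variable
    A X Y : Set

-- Booleans deciding propositions

Means : Bool → Set → Set
Means b P = (b ≡ true → P) × (P → b ≡ true)

means-map : ∀ {b} {P Q : Set} → Means b P → (P → Q) → (Q → P) → Means b Q
means-map (b⇒P , P⇒b) P⇒Q Q⇒P = (λ b≡t → P⇒Q (b⇒P b≡t)) , (λ q → P⇒b (Q⇒P q))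

means-subst : ∀ {a b} {P : Set} → a ≡ b → Means a P → Means b P
means-subst refl a⇔P = a⇔P

means-trans : ∀ {b} {x y m : ℕ} → x ≡ y → Means b (y ≡ m) → Means b (x ≡ m)
means-trans x≡y b⇔y≡m = means-map b⇔y≡m (trans x≡y) (trans (sym x≡y))

means-unique : ∀ {a b} {P : Set} → Means a P → Means b P → a ≡ b
means-unique {true}  {true}  _         _         = refl
means-unique {true}  {false} (a⇒P , _) (_ , P⇒b) = sym (P⇒b (a⇒P refl))
means-unique {false} {true}  (_ , P⇒a) (b⇒P , _) = P⇒a (b⇒P refl)
means-unique {false} {false} _         _         = refl

means-true : ∀ {b} → Means b (b ≡ true)
means-true = (λ b≡t → b≡t) , (λ b≡t → b≡t)

means-does : {P : Set} (P? : Dec P) → Means (does P?) P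
means-does (yes p) = (λ _ → p) , (λ _ → refl)
means-does (no ¬p) = (λ ()) , (λ p → ⊥-elim (¬p p))

means-not : ∀ {b} {P : Set} → Means b P → Means (not b) (¬ P)
means-not {true}  (b⇒P , _) = (λ ()) , (λ ¬p → ⊥-elim (¬p (b⇒P refl)))
means-not {false} (_ , P⇒b) = (λ _ p → case P⇒b p of λ ()) , (λ _ → refl)

means-∧ : ∀ {a b} {P Q : Set} → Means a P → Means b Q → Means (a ∧ b) (P × Q)
means-∧ {true}  (a⇒P , _) (b⇒Q , Q⇒b) = (λ b≡t → a⇒P refl , b⇒Q b≡t) , (λ pq → Q⇒b (proj₂ pq))
means-∧ {false} (_ , P⇒a) _           = (λ ()) , (λ pq → P⇒a (proj₁ pq))

means-∨ : ∀ {a b} {P Q : Set} → Means a P → Means b Q → Means (not (not a ∧ not b)) (P ⊎ Q)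
means-∨ {true}          (a⇒P , _)   _           = (λ _ → inj₁ (a⇒P refl)) , (λ _ → refl)
means-∨ {false} {true}  _           (b⇒Q , _)   = (λ _ → inj₂ (b⇒Q refl)) , (λ _ → refl)
means-∨ {false} {false} (_ , P⇒a)   (_ , Q⇒b)   = (λ ()) , λ { (inj₁ p) → P⇒a p ; (inj₂ q) → Q⇒b q }

-- Counting in lists

χ : Bool → ℕ
χ true  = 1
χ false = 0

count-∷ : (p : A → Bool) (x : A) (xs : List A) → count p (x ∷ xs) ≡ χ (p x) + count p xs
count-∷ p x xs with p x
... | true  = refl
... | false = refl

count-cong : (p q : A → Bool) (xs : List A) → (∀ {x} → x ∈ xs → p x ≡ q x) → count p xs ≡ count q xs
count-cong p q []       p≗q = refl
count-cong p q (x ∷ xs) p≗q = begin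
  count p (x ∷ xs)          ≡⟨ count-∷ p x xs ⟩
  χ (p x) + count p xs      ≡⟨ cong₂ _+_ (cong χ (p≗q (here refl))) (count-cong p q xs (λ m → p≗q (there m))) ⟩
  χ (q x) + count q xs      ≡⟨ sym (count-∷ q x xs) ⟩
  count q (x ∷ xs)          ∎
  where open ≡-Reasoning

count-++ : (p : A → Bool) (xs ys : List A) → count p (xs ++ ys) ≡ count p xs + count p ys
count-++ p []       ys = refl
count-++ p (x ∷ xs) ys = begin
  count p (x ∷ xs ++ ys)              ≡⟨ count-∷ p x (xs ++ ys) ⟩
  χ (p x) + count p (xs ++ ys)        ≡⟨ cong (χ (p x) +_) (count-++ p xs ys) ⟩
  χ (p x) + (count p xs + count p ys) ≡⟨ sym (+-assoc (χ (p x)) _ _) ⟩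
  χ (p x) + count p xs + count p ys   ≡⟨ cong (_+ count p ys) (sym (count-∷ p x xs)) ⟩
  count p (x ∷ xs) + count p ys       ∎
  where open ≡-Reasoning

count-map : (p : Y → Bool) (f : X → Y) (xs : List X) → count p (map f xs) ≡ count (λ x → p (f x)) xs
count-map p f []       = refl
count-map p f (x ∷ xs) = begin
  count p (f x ∷ map f xs)                ≡⟨ count-∷ p (f x) (map f xs) ⟩
  χ (p (f x)) + count p (map f xs)        ≡⟨ cong (χ (p (f x)) +_) (count-map p f xs) ⟩
  χ (p (f x)) + count (λ x → p (f x)) xs  ≡⟨ sym (count-∷ (λ x → p (f x)) x xs) ⟩
  count (λ x → p (f x)) (x ∷ xs)          ∎
  where open ≡-Reasoning

count≡0⇒rejected : (p : A → Bool) (xs : List A) → count p xs ≡ 0 → ∀ {x} → x ∈ xs → p x ≡ false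
count≡0⇒rejected p (x ∷ xs) c≡0 x∈ with p x in px | x∈
... | false | here refl = px
... | false | there x∈xs = count≡0⇒rejected p xs c≡0 x∈xs

rejected⇒count≡0 : (p : A → Bool) (xs : List A) → (∀ {x} → x ∈ xs → p x ≡ false) → count p xs ≡ 0
rejected⇒count≡0 p []       rej = refl
rejected⇒count≡0 p (x ∷ xs) rej with p x | rej (here refl)
... | false | refl = rejected⇒count≡0 p xs (λ x∈ → rej (there x∈))

private
  remove : {z : A} {ws : List A} → z ∈ ws →
           Σ (List A) λ ws' → length ws ≡ suc (length ws') × (∀ {y} → y ∈ ws → ¬ y ≡ z → y ∈ ws')
  remove {z = z} z∈ws with ∈-∃++ z∈ws
  ... | as , bs , refl = as ++ bs , length-removed , keep
    where
    length-removed : length (as ++ z ∷ bs) ≡ suc (length (as ++ bs))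
    length-removed = begin
      length (as ++ z ∷ bs)              ≡⟨ length-++ as ⟩
      length as + suc (length bs)        ≡⟨ +-suc (length as) (length bs) ⟩
      suc (length as + length bs)        ≡⟨ cong suc (sym (length-++ as)) ⟩
      suc (length (as ++ bs))            ∎
      where open ≡-Reasoning
    keep : ∀ {y} → y ∈ as ++ z ∷ bs → ¬ y ≡ z → y ∈ as ++ bs
    keep y∈ y≢z with ∈-++⁻ as y∈
    ... | inj₁ y∈as          = ∈-++⁺ˡ y∈as
    ... | inj₂ (here y≡z)    = ⊥-elim (y≢z y≡z)
    ... | inj₂ (there y∈bs)  = ∈-++⁺ʳ as y∈bs

  Unique-⊆⇒length-≤ : (zs ws : List A) → Unique zs → (∀ {z} → z ∈ zs → z ∈ ws) → length zs ≤ length ws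
  Unique-⊆⇒length-≤ []       ws _           _  = z≤n
  Unique-⊆⇒length-≤ (z ∷ zs) ws (z∉ ∷ uniq) zs⊆ws with remove (zs⊆ws (here refl))
  ... | ws' , len , keep = subst (suc (length zs) ≤_) (sym len) (s≤s (Unique-⊆⇒length-≤ zs ws' uniq zs⊆ws'))
    where
    zs⊆ws' : ∀ {y} → y ∈ zs → y ∈ ws'
    zs⊆ws' y∈ = keep (zs⊆ws (there y∈)) (λ y≡z → All-lookup z∉ y∈ (sym y≡z))

  Unique-map⁺ : (g : X → Y) (zs : List X) → Unique zs →
                (∀ {x y} → x ∈ zs → y ∈ zs → g x ≡ g y → x ≡ y) → Unique (map g zs)
  Unique-map⁺ g []       _         _   = []
  Unique-map⁺ g (z ∷ zs) (z∉ ∷ uniq) inj =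
    distinct zs z∉ (λ y∈ → y∈) ∷ Unique-map⁺ g zs uniq (λ x∈ y∈ → inj (there x∈) (there y∈))
    where
    distinct : (ys : List _) → All (λ y → ¬ z ≡ y) ys → (∀ {y} → y ∈ ys → y ∈ zs) →
               All (λ y → ¬ g z ≡ y) (map g ys)
    distinct []       []         _     = []
    distinct (y ∷ ys) (z≢y ∷ z∉) ys⊆zs =
      (λ gz≡gy → z≢y (inj (here refl) (there (ys⊆zs (here refl))) gz≡gy))
      ∷ distinct ys z∉ (λ y∈ → ys⊆zs (there y∈))

count-≤-retract : (p : X → Bool) (q : Y → Bool) (xs : List X) (ys : List Y) → Unique xs →
  (g : X → Y) (g⁻ : Y → X) →
  (∀ {x} → x ∈ xs → p x ≡ true → g x ∈ ys × q (g x) ≡ true) →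
  (∀ {x} → x ∈ xs → p x ≡ true → g⁻ (g x) ≡ x) →
  count p xs ≤ count q ys
count-≤-retract p q xs ys uniq g g⁻ into retract =
  subst (_≤ count q ys) (length-map g (filter p? xs))
    (Unique-⊆⇒length-≤ (map g (filter p? xs)) (filter q? ys)
      (Unique-map⁺ g _ (filter⁺ p? uniq) injective) image⊆)
  where
  p? = λ x → p x ≟ᵇ true
  q? = λ y → q y ≟ᵇ true
  injective : ∀ {x x'} → x ∈ filter p? xs → x' ∈ filter p? xs → g x ≡ g x' → x ≡ x'
  injective x∈ x'∈ gx≡gx' with ∈-filter⁻ p? x∈ | ∈-filter⁻ p? x'∈
  ... | x∈xs , px | x'∈xs , px' =
    trans (sym (retract x∈xs px)) (trans (cong g⁻ gx≡gx') (retract x'∈xs px'))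
  image⊆ : ∀ {y} → y ∈ map g (filter p? xs) → y ∈ filter q? ys
  image⊆ y∈ with ∈-map⁻ g y∈
  ... | x , x∈ , refl with ∈-filter⁻ p? x∈
  ...   | x∈xs , px with into x∈xs px
  ...     | gx∈ys , qgx = ∈-filter⁺ q? gx∈ys qgx

count-bijection : (p : X → Bool) (q : Y → Bool) (xs : List X) (ys : List Y) → Unique xs → Unique ys →
  (g : X → Y) (g⁻ : Y → X) →
  (∀ {x} → x ∈ xs → p x ≡ true → g x ∈ ys × q (g x) ≡ true) →
  (∀ {y} → y ∈ ys → q y ≡ true → g⁻ y ∈ xs × p (g⁻ y) ≡ true) →
  (∀ {x} → x ∈ xs → p x ≡ true → g⁻ (g x) ≡ x) →
  (∀ {y} → y ∈ ys → q y ≡ true → g (g⁻ y) ≡ y) →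
  count p xs ≡ count q ys
count-bijection p q xs ys uxs uys g g⁻ into into⁻ left right =
  ≤-antisym (count-≤-retract p q xs ys uxs g g⁻ into left)
            (count-≤-retract q p ys xs uys g⁻ g into⁻ right)

∑ : List A → (A → ℕ) → ℕ
∑ []       f = 0
∑ (x ∷ xs) f = f x + ∑ xs f

syntax ∑ xs (λ x → e) = ∑[ x ∈ xs ] e

∑-cong : (xs : List A) {f g : A → ℕ} → (∀ {x} → x ∈ xs → f x ≡ g x) → ∑ xs f ≡ ∑ xs g
∑-cong []       f≗g = refl
∑-cong (x ∷ xs) f≗g = cong₂ _+_ (f≗g (here refl)) (∑-cong xs (λ x∈ → f≗g (there x∈)))

∑-zero : (xs : List A) → ∑[ x ∈ xs ] 0 ≡ 0
∑-zero []       = refl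
∑-zero (x ∷ xs) = ∑-zero xs

∑-+ : (xs : List A) (f g : A → ℕ) → ∑[ x ∈ xs ] (f x + g x) ≡ ∑ xs f + ∑ xs g
∑-+ []       f g = refl
∑-+ (x ∷ xs) f g = trans (cong (f x + g x +_) (∑-+ xs f g)) (+-interchange (f x) (g x) (∑ xs f) (∑ xs g))

∑-swap : (xs : List X) (ys : List Y) (f : X → Y → ℕ) →
         ∑[ x ∈ xs ] ∑[ y ∈ ys ] f x y ≡ ∑[ y ∈ ys ] ∑[ x ∈ xs ] f x y
∑-swap []       ys f = sym (∑-zero ys)
∑-swap (x ∷ xs) ys f = begin
  ∑ ys (f x) + ∑[ x ∈ xs ] ∑[ y ∈ ys ] f x y     ≡⟨ cong (∑ ys (f x) +_) (∑-swap xs ys f) ⟩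
  ∑ ys (f x) + ∑[ y ∈ ys ] ∑[ x ∈ xs ] f x y     ≡⟨ sym (∑-+ ys (f x) _) ⟩
  ∑[ y ∈ ys ] (f x y + ∑[ x ∈ xs ] f x y)        ∎
  where open ≡-Reasoning

count≡∑χ : (p : A → Bool) (xs : List A) → count p xs ≡ ∑[ x ∈ xs ] χ (p x)
count≡∑χ p []       = refl
count≡∑χ p (x ∷ xs) = trans (count-∷ p x xs) (cong (χ (p x) +_) (count≡∑χ p xs))

count-≡-allFin : ∀ m (w : Fin m) → count (λ v → does (w ≟F v)) (allFin m) ≡ 1
count-≡-allFin m w = count-bijection (λ v → does (w ≟F v)) (λ _ → true) (allFin m) (tt ∷ [])
  (allFin⁺ m) ([] ∷ []) (λ _ → tt) (λ _ → w)
  (λ _ _ → here refl , refl) (λ _ _ → ∈-allFin w , dec-true (w ≟F w) refl)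
  (λ {v} _ w≟v → proj₁ (means-does (w ≟F v)) w≟v) (λ {tt} _ _ → refl)

count-fibres : (p : A → Bool) (m : ℕ) (key : A → Fin m) (xs : List A) →
  count p xs ≡ ∑[ v ∈ allFin m ] count (λ x → p x ∧ does (key x ≟F v)) xs
count-fibres p m key xs = begin
  count p xs                                                  ≡⟨ count≡∑χ p xs ⟩
  ∑[ x ∈ xs ] χ (p x)                                         ≡⟨ ∑-cong xs (λ {x} _ → fibre x) ⟩
  ∑[ x ∈ xs ] ∑[ v ∈ allFin m ] χ (p x ∧ does (key x ≟F v))   ≡⟨ ∑-swap xs (allFin m) _ ⟩
  ∑[ v ∈ allFin m ] ∑[ x ∈ xs ] χ (p x ∧ does (key x ≟F v))
    ≡⟨ ∑-cong (allFin m) (λ _ → sym (count≡∑χ _ xs)) ⟩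
  ∑[ v ∈ allFin m ] count (λ x → p x ∧ does (key x ≟F v)) xs  ∎
  where
  open ≡-Reasoning
  fibre : ∀ x → χ (p x) ≡ ∑[ v ∈ allFin m ] χ (p x ∧ does (key x ≟F v))
  fibre x with p x
  ... | true  = trans (sym (count-≡-allFin m (key x))) (count≡∑χ _ (allFin m))
  ... | false = sym (∑-zero (allFin m))

count-× : (p : X → Bool) (q : Y → Bool) (xs : List X) (ys : List Y) →
  count (λ z → p (proj₁ z) ∧ q (proj₂ z)) (cartesianProduct xs ys) ≡ count p xs * count q ys
count-× p q []       ys = refl
count-× p q (x ∷ xs) ys = begin
  count pq (map (x ,_) ys ++ cartesianProduct xs ys)
    ≡⟨ count-++ pq (map (x ,_) ys) _ ⟩
  count pq (map (x ,_) ys) + count pq (cartesianProduct xs ys)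
    ≡⟨ cong₂ _+_ (count-map pq (x ,_) ys) (count-× p q xs ys) ⟩
  count (λ y → p x ∧ q y) ys + count p xs * count q ys
    ≡⟨ cong (_+ count p xs * count q ys) (row (p x)) ⟩
  χ (p x) * count q ys + count p xs * count q ys
    ≡⟨ sym (*-distribʳ-+ (count q ys) (χ (p x)) (count p xs)) ⟩
  (χ (p x) + count p xs) * count q ys
    ≡⟨ cong (_* count q ys) (sym (count-∷ p x xs)) ⟩
  count p (x ∷ xs) * count q ys
    ∎
  where
  open ≡-Reasoning
  pq = λ z → p (proj₁ z) ∧ q (proj₂ z)
  row : (b : Bool) → count (λ y → b ∧ q y) ys ≡ χ b * count q ys
  row true  = sym (+-identityʳ (count q ys))
  row false = rejected⇒count≡0 (λ _ → false) ys (λ _ → refl)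

-- Enumerating maps

private
  concatMap-map≡cartesianProductWith : (f : X → Y → A) (xs : List X) (ys : List Y) →
    concatMap (λ x → map (f x) ys) xs ≡ cartesianProductWith f xs ys
  concatMap-map≡cartesianProductWith f []       ys = refl
  concatMap-map≡cartesianProductWith f (x ∷ xs) ys =
    cong (map (f x) ys ++_) (concatMap-map≡cartesianProductWith f xs ys)

  ∷-injective : ∀ {a b} {x y : Fin b} {xs ys : Vec (Fin b) a} → x ∷ xs ≡ y ∷ ys → x ≡ y × xs ≡ ys
  ∷-injective refl = refl , refl

allMaps-unique : ∀ a b → Unique (allMaps a b)
allMaps-unique zero    b = [] ∷ []
allMaps-unique (suc a) b =
  subst Unique (sym (concatMap-map≡cartesianProductWith _∷_ (allFin b) (allMaps a b)))
    (cartesianProductWith⁺ _∷_ ∷-injective (allFin⁺ b) (allMaps-unique a b))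

∈-allMaps : ∀ {a b} (h : Vec (Fin b) a) → h ∈ allMaps a b
∈-allMaps []                = here refl
∈-allMaps {suc a} {b} (x ∷ h) =
  subst ((x ∷ h) ∈_) (sym (concatMap-map≡cartesianProductWith _∷_ (allFin b) (allMaps a b)))
    (∈-cartesianProductWith⁺ _∷_ (∈-allFin x) (∈-allMaps h))

vec-ext : ∀ {m} (xs ys : Vec A m) → (∀ i → lookup xs i ≡ lookup ys i) → xs ≡ ys
vec-ext xs ys eqs = trans (sym (tabulate∘lookup xs)) (trans (tabulate-cong eqs) (tabulate∘lookup ys))

MapFamily : (c : ℕ) → (Fin c → ℕ) → ℕ → Set
MapFamily zero    d b = ⊤
MapFamily (suc c) d b = Vec (Fin b) (d zero) × MapFamily c (λ i → d (suc i)) b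

allMapFamilies : ∀ c d b → List (MapFamily c d b)
allMapFamilies zero    d b = tt ∷ []
allMapFamilies (suc c) d b = cartesianProduct (allMaps (d zero) b) (allMapFamilies c (λ i → d (suc i)) b)

component : ∀ {c d b} → MapFamily c d b → (i : Fin c) → Vec (Fin b) (d i)
component {suc c} (h , hs) zero    = h
component {suc c} (h , hs) (suc i) = component hs i

family : ∀ {c d b} → ((i : Fin c) → Vec (Fin b) (d i)) → MapFamily c d b
family {zero}  hs = tt
family {suc c} hs = hs zero , family (λ i → hs (suc i))

component-family : ∀ {c d b} (hs : (i : Fin c) → Vec (Fin b) (d i)) i → component (family {c} {d} {b} hs) i ≡ hs i
component-family {suc c} hs zero    = refl
component-family {suc c} hs (suc i) = component-family (λ i → hs (suc i)) i

family-ext : ∀ {c d b} (hs hs' : MapFamily c d b) → (∀ i → component hs i ≡ component hs' i) → hs ≡ hs'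
family-ext {zero}  tt       tt         eqs = refl
family-ext {suc c} (h , hs) (h' , hs') eqs = cong₂ _,_ (eqs zero) (family-ext hs hs' (λ i → eqs (suc i)))

allMapFamilies-unique : ∀ c d b → Unique (allMapFamilies c d b)
allMapFamilies-unique zero    d b = [] ∷ []
allMapFamilies-unique (suc c) d b = cartesianProduct⁺ (allMaps-unique (d zero) b) (allMapFamilies-unique c _ b)

∈-allMapFamilies : ∀ {c d b} (hs : MapFamily c d b) → hs ∈ allMapFamilies c d b
∈-allMapFamilies {zero}  tt       = here refl
∈-allMapFamilies {suc c} (h , hs) = ∈-cartesianProductWith⁺ _,_ (∈-allMaps h) (∈-allMapFamilies hs)

∀-components : ∀ {c d b} → ((i : Fin c) → Vec (Fin b) (d i) → Bool) → MapFamily c d b → Bool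
∀-components {zero}  P tt       = true
∀-components {suc c} P (h , hs) = P zero h ∧ ∀-components (λ i → P (suc i)) hs

∏ : (c : ℕ) → (Fin c → ℕ) → ℕ
∏ zero    x = 1
∏ (suc c) x = x zero * ∏ c (λ i → x (suc i))

count-allMapFamilies : ∀ c d b (P : (i : Fin c) → Vec (Fin b) (d i) → Bool) →
  count (∀-components P) (allMapFamilies c d b) ≡ ∏ c (λ i → count (P i) (allMaps (d i) b))
count-allMapFamilies zero    d b P = refl
count-allMapFamilies (suc c) d b P =
  trans (count-× (P zero) (∀-components (λ i → P (suc i))) (allMaps (d zero) b) _)
        (cong (count (P zero) (allMaps (d zero) b) *_) (count-allMapFamilies c _ b (λ i → P (suc i))))

-- Derived connectives of counting logic

module _ {k q : ℕ} where

  ⊥f : Form k q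
  ⊥f = ¬f ⊤f

  _∨f_ : Form k q → Form k q → Form k q
  φ ∨f ψ = ¬f (¬f φ ∧f ¬f ψ)

  constF : Bool → Form k q
  constF true  = ⊤f
  constF false = ⊥f

  ⋀ : ∀ {m} → (Fin m → Form k q) → Form k q
  ⋀ {zero}  φ = ⊤f
  ⋀ {suc m} φ = φ zero ∧f ⋀ (λ i → φ (suc i))

  ⋁≤ : (ℕ → Form k q) → ℕ → Form k q
  ⋁≤ φ zero    = φ zero
  ⋁≤ φ (suc r) = φ (suc r) ∨f ⋁≤ φ r

  ⋁< : (ℕ → Form k q) → ℕ → Form k q
  ⋁< φ zero    = ⊥f
  ⋁< φ (suc j) = φ j ∨f ⋁< φ j

  ∃= : ℕ → Fin k → Form k q → Form k (suc q)
  ∃= a ℓ φ = ∃≥ a ℓ φ ∧f ¬f (∃≥ (suc a) ℓ φ)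

_[_↦_] : ∀ {k} {V : Set} → (Fin k → Maybe V) → Fin k → V → Fin k → Maybe V
(α [ ℓ ↦ v ]) j = if does (j ≟F ℓ) then just v else α j

module _ {k q : ℕ} (G : LGraph k) (α : Fin k → Maybe (Fin (n G))) where

  means-constF : ∀ b {P : Set} → Means b P → Means (sat {q = q} G (constF b) α) P
  means-constF true  b⇔P = b⇔P
  means-constF false b⇔P = b⇔P

  means-⋀ : ∀ {m} (φ : Fin m → Form k q) {P : Fin m → Set} →
    (∀ i → Means (sat G (φ i) α) (P i)) → Means (sat G (⋀ φ) α) (∀ i → P i)
  means-⋀ {zero}  φ φ⇔P = (λ _ ()) , (λ _ → refl)
  means-⋀ {suc m} φ φ⇔P =
    means-map (means-∧ (φ⇔P zero) (means-⋀ (λ i → φ (suc i)) (λ i → φ⇔P (suc i))))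
      (λ { (p , ps) zero → p ; (p , ps) (suc i) → ps i })
      (λ ps → ps zero , (λ i → ps (suc i)))

  means-⋁≤ : (φ : ℕ → Form k q) {P : ℕ → Set} → (∀ a → Means (sat G (φ a) α) (P a)) →
    ∀ r → Means (sat G (⋁≤ φ r) α) (∃ λ a → a ≤ r × P a)
  means-⋁≤ φ φ⇔P zero    = means-map (φ⇔P 0) (λ p → 0 , z≤n , p) (λ { (zero , _ , p) → p })
  means-⋁≤ φ {P} φ⇔P (suc r) = means-map (means-∨ (φ⇔P (suc r)) (means-⋁≤ φ φ⇔P r))
    (λ { (inj₁ p) → suc r , ≤-refl , p ; (inj₂ (a , a≤r , p)) → a , m≤n⇒m≤1+n a≤r , p })
    (λ { (a , a≤1+r , p) → split a≤1+r p })
    where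
    split : ∀ {a} → a ≤ suc r → P a → P (suc r) ⊎ ∃ λ a → a ≤ r × P a
    split {a} a≤1+r p with m≤n⇒m<n∨m≡n a≤1+r
    ... | inj₁ (s≤s a≤r) = inj₂ (a , a≤r , p)
    ... | inj₂ refl      = inj₁ p

  means-⋁< : (φ : ℕ → Form k q) {P : ℕ → Set} → (∀ a → Means (sat G (φ a) α) (P a)) →
    ∀ j → Means (sat G (⋁< φ j) α) (∃ λ a → a < j × P a)
  means-⋁< φ φ⇔P zero    = (λ ()) , (λ { (a , () , _) })
  means-⋁< φ {P} φ⇔P (suc j) = means-map (means-∨ (φ⇔P j) (means-⋁< φ φ⇔P j))
    (λ { (inj₁ p) → j , ≤-refl , p ; (inj₂ (a , a<j , p)) → a , m≤n⇒m≤1+n a<j , p })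
    (λ { (a , a<1+j , p) → split a<1+j p })
    where
    split : ∀ {a} → a < suc j → P a → P j ⊎ ∃ λ a → a < j × P a
    split {a} (s≤s a≤j) p with m≤n⇒m<n∨m≡n a≤j
    ... | inj₁ a<j  = inj₂ (a , a<j , p)
    ... | inj₂ refl = inj₁ p

  witnesses : Fin k → Form k q → ℕ
  witnesses ℓ φ = count (λ v → sat G φ (α [ ℓ ↦ v ])) (allFin (n G))

  means-∃≥ : ∀ t ℓ (φ : Form k q) → Means (sat G (∃≥ t ℓ φ) α) (t ≤ witnesses ℓ φ)
  means-∃≥ t ℓ φ = means-does (t ≤? witnesses ℓ φ)

  means-∃= : ∀ a ℓ (φ : Form k q) → Means (sat G (∃= a ℓ φ) α) (witnesses ℓ φ ≡ a)
  means-∃= a ℓ φ = means-map (means-∧ (means-∃≥ a ℓ φ) (means-not (means-∃≥ (suc a) ℓ φ)))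
    (λ { (a≤w , w≱1+a) → ≤-antisym (≮⇒≥ w≱1+a) a≤w })
    (λ { refl → ≤-refl , n≮n (witnesses ℓ φ) })

-- Homomorphisms up to tolerated edges

Tolerance : ℕ → Set
Tolerance k = Fin k → Fin k → Bool

_≟M_ : ∀ {m} (x y : Maybe (Fin m)) → Dec (x ≡ y)
_≟M_ = ≡-decMaybe _≟F_

Edge : ∀ {k} (G : LGraph k) → Fin (n G) → Fin (n G) → Set
Edge G x y = adj G x y ≡ true

module _ {k : ℕ} (S : Tolerance k) where

  Tolerated : (F : LGraph k) → Fin (n F) → Fin (n F) → Set
  Tolerated F u v = Σ (Fin k) λ a → Σ (Fin k) λ b → S a b ≡ true × ν F a ≡ just u × ν F b ≡ just v

  tolerated? : (F : LGraph k) (u v : Fin (n F)) → Dec (Tolerated F u v)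
  tolerated? F u v = any? λ a → any? λ b → (S a b ≟ᵇ true) ×-dec (ν F a ≟M just u) ×-dec (ν F b ≟M just v)

  PreservesEdgesExcept : (F G : LGraph k) → Vec (Fin (n G)) (n F) → Set
  PreservesEdgesExcept F G h = ∀ u v → Edge F u v → Tolerated F u v ⊎ Edge G (lookup h u) (lookup h v)

  PreservesLabels : (F G : LGraph k) → Vec (Fin (n G)) (n F) → Set
  PreservesLabels F G h = ∀ ℓ a → ν F ℓ ≡ just a → ν G ℓ ≡ just (lookup h a)

  IsHomExcept : (F G : LGraph k) → Vec (Fin (n G)) (n F) → Set
  IsHomExcept F G h = PreservesEdgesExcept F G h × PreservesLabels F G h

  isHomExcept? : (F G : LGraph k) (h : Vec (Fin (n G)) (n F)) → Dec (IsHomExcept F G h)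
  isHomExcept? F G h =
    (all? λ u → all? λ v → (adj F u v ≟ᵇ true) →-dec
                             (tolerated? F u v ⊎-dec (adj G (lookup h u) (lookup h v) ≟ᵇ true)))
    ×-dec (all? λ ℓ → all? λ a → (ν F ℓ ≟M just a) →-dec (ν G ℓ ≟M just (lookup h a)))

  homExcept : LGraph k → LGraph k → ℕ
  homExcept F G = count (λ h → does (isHomExcept? F G h)) (allMaps (n F) (n G))

  means-isHomExcept : (F G : LGraph k) (h : Vec (Fin (n G)) (n F)) →
                      Means (does (isHomExcept? F G h)) (IsHomExcept F G h)
  means-isHomExcept F G h = means-does (isHomExcept? F G h)

  accepted⇒hom : (F G : LGraph k) (h : Vec (Fin (n G)) (n F)) →
                 does (isHomExcept? F G h) ≡ true → IsHomExcept F G h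
  accepted⇒hom F G h = proj₁ (means-isHomExcept F G h)

  hom⇒accepted : (F G : LGraph k) (h : Vec (Fin (n G)) (n F)) →
                 IsHomExcept F G h → does (isHomExcept? F G h) ≡ true
  hom⇒accepted F G h = proj₂ (means-isHomExcept F G h)

noTolerance : ∀ {k} → Tolerance k
noTolerance _ _ = false

private
  means-allB : ∀ {m} (p : Fin m → Bool) → Means (allB p (allFin m)) (∀ x → p x ≡ true)
  means-allB {m} p = means-map (go (allFin m)) (λ all x → all (∈-allFin x)) (λ all _ → all _)
    where
    go : (xs : List (Fin m)) → Means (allB p xs) (∀ {x} → x ∈ xs → p x ≡ true)
    go []       = (λ _ ()) , (λ _ → refl)
    go (x ∷ xs) = means-map (means-∧ {p x} means-true (go xs))
      (λ { (px , all) (here refl) → px ; (px , all) (there x∈) → all x∈ })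
      (λ all → all (here refl) , (λ x∈ → all (there x∈)))

  means-implies : ∀ a b → Means (not a ∨ b) (a ≡ true → b ≡ true)
  means-implies true  b = (λ b≡t _ → b≡t) , (λ a⇒b → a⇒b refl)
  means-implies false b = (λ _ ()) , (λ _ → refl)

  -- The label test of Defs.isHom is local to its where block; the existential names it.
  isHom-labelTest : ∀ {k} (F G : LGraph k) h → Σ (Fin k → Bool) λ test →
    isHom F G h ≡ (allB (λ u → allB (λ v → not (adj F u v) ∨ adj G (lookup h u) (lookup h v))
                                     (allFin (n F))) (allFin (n F)) ∧ allB test (allFin k))
  isHom-labelTest F G h = _ , refl

  means-labelTest : ∀ {k} (F G : LGraph k) h ℓ →
    Means (proj₁ (isHom-labelTest F G h) ℓ) (∀ a → ν F ℓ ≡ just a → ν G ℓ ≡ just (lookup h a))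
  means-labelTest F G h ℓ with ν F ℓ
  ... | nothing = (λ _ _ ()) , (λ _ → refl)
  ... | just a with ν G ℓ
  ...   | nothing = (λ ()) , (λ labels → case labels a refl of λ ())
  ...   | just w  = means-map (means-does (lookup h a ≟F w))
                      (λ { ha≡w .a refl → cong just (sym ha≡w) }) (λ labels → sym (just-injective (labels a refl)))

  means-isHom : ∀ {k} (F G : LGraph k) h → Means (isHom F G h) (IsHomExcept noTolerance F G h)
  means-isHom F G h = means-∧
    (means-map (means-allB _)
      (λ edges u v uv → inj₂ (proj₁ (means-implies _ _) (proj₁ (means-allB _) (edges u) v) uv))
      (λ edges u → proj₂ (means-allB _) (λ v → proj₂ (means-implies _ _) (λ uv → untolerated (edges u v uv)))))
    (means-map (means-allB _)
      (λ tests ℓ → proj₁ (means-labelTest F G h ℓ) (tests ℓ))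
      (λ labels ℓ → proj₂ (means-labelTest F G h ℓ) (labels ℓ)))
    where
    untolerated : ∀ {u v} → Tolerated noTolerance F u v ⊎ Edge G (lookup h u) (lookup h v) →
                  Edge G (lookup h u) (lookup h v)
    untolerated (inj₁ (_ , _ , () , _))
    untolerated (inj₂ huv) = huv

hom≡homExcept : ∀ {k} (F G : LGraph k) → hom F G ≡ homExcept noTolerance F G
hom≡homExcept F G = count-cong _ _ (allMaps (n F) (n G))
  (λ {h} _ → means-unique (means-isHom F G h) (means-isHomExcept noTolerance F G h))

-- Invariance under isomorphism

map≡just⁻ : ∀ {B : Set} (f : A → B) (m : Maybe A) {y : B} →
            Maybe.map f m ≡ just y → ∃ λ x → m ≡ just x × f x ≡ y
map≡just⁻ f (just x) refl = x , refl , refl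

module _ {k : ℕ} (S : Tolerance k) {F H : LGraph k} (F≅H : F ≅ H) (G : LGraph k) where
  open Realizes F≅H

  private
    f⁻ : Fin (n F) → Fin (n H)
    f⁻ x = proj₁ (surj x)

    f∘f⁻ : ∀ x → f (f⁻ x) ≡ x
    f∘f⁻ x = proj₂ (surj x)

    f⁻∘f : ∀ u → f⁻ (f u) ≡ u
    f⁻∘f u = reflect (f⁻ (f u)) u (f∘f⁻ (f u))

    labelF : ∀ ℓ u → ν H ℓ ≡ just u → ν F ℓ ≡ just (f u)
    labelF ℓ u νu = trans (labels ℓ) (cong (Maybe.map f) νu)

    labelH : ∀ ℓ x → ν F ℓ ≡ just x → ν H ℓ ≡ just (f⁻ x)
    labelH ℓ x νx with map≡just⁻ f (ν H ℓ) (trans (sym (labels ℓ)) νx)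
    ... | u , νu , fu≡x = trans νu (cong just (reflect u (f⁻ x) (trans fu≡x (sym (f∘f⁻ x)))))

    toH : Vec (Fin (n G)) (n F) → Vec (Fin (n G)) (n H)
    toH h = tabulate (λ u → lookup h (f u))

    toF : Vec (Fin (n G)) (n H) → Vec (Fin (n G)) (n F)
    toF h = tabulate (λ x → lookup h (f⁻ x))

    lookup-toH : ∀ h u → lookup (toH h) u ≡ lookup h (f u)
    lookup-toH h = lookup∘tabulate (λ u → lookup h (f u))

    lookup-toF : ∀ h x → lookup (toF h) x ≡ lookup h (f⁻ x)
    lookup-toF h = lookup∘tabulate (λ x → lookup h (f⁻ x))

    toH-hom : ∀ h → IsHomExcept S F G h → IsHomExcept S H G (toH h)
    toH-hom h (edges , labs) = edges′ , labs′
      where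
      edges′ : PreservesEdgesExcept S H G (toH h)
      edges′ u v uv with edges (f u) (f v) (edge⇐ u v uv)
      ... | inj₁ (a , b , Sab , νa , νb) =
        inj₁ (a , b , Sab , trans (labelH a _ νa) (cong just (f⁻∘f u)) , trans (labelH b _ νb) (cong just (f⁻∘f v)))
      ... | inj₂ huv = inj₂ (subst₂ (Edge G) (sym (lookup-toH h u)) (sym (lookup-toH h v)) huv)
      labs′ : PreservesLabels S H G (toH h)
      labs′ ℓ a νa = trans (labs ℓ (f a) (labelF ℓ a νa)) (cong just (sym (lookup-toH h a)))

    toF-hom : ∀ h → IsHomExcept S H G h → IsHomExcept S F G (toF h)
    toF-hom h (edges , labs) = edges′ , labs′
      where
      edges′ : PreservesEdgesExcept S F G (toF h)
      edges′ x y xy with edges (f⁻ x) (f⁻ y) (edge⇒ _ _ (subst₂ (Edge F) (sym (f∘f⁻ x)) (sym (f∘f⁻ y)) xy))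
      ... | inj₁ (a , b , Sab , νa , νb) =
        inj₁ (a , b , Sab , trans (labelF a _ νa) (cong just (f∘f⁻ x)) , trans (labelF b _ νb) (cong just (f∘f⁻ y)))
      ... | inj₂ huv = inj₂ (subst₂ (Edge G) (sym (lookup-toF h x)) (sym (lookup-toF h y)) huv)
      labs′ : PreservesLabels S F G (toF h)
      labs′ ℓ x νx = trans (labs ℓ (f⁻ x) (labelH ℓ x νx)) (cong just (sym (lookup-toF h x)))

  homExcept-≅ : homExcept S F G ≡ homExcept S H G
  homExcept-≅ = count-bijection (λ h → does (isHomExcept? S F G h)) (λ h → does (isHomExcept? S H G h))
    (allMaps (n F) (n G)) (allMaps (n H) (n G)) (allMaps-unique _ _) (allMaps-unique _ _) toH toF
    (λ {h} _ ok → ∈-allMaps (toH h) , hom⇒accepted S H G (toH h) (toH-hom h (accepted⇒hom S F G h ok)))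
    (λ {h} _ ok → ∈-allMaps (toF h) , hom⇒accepted S F G (toF h) (toF-hom h (accepted⇒hom S H G h ok)))
    (λ {h} _ _ → vec-ext _ _ λ x →
      trans (lookup-toF (toH h) x) (trans (lookup-toH h (f⁻ x)) (cong (lookup h) (f∘f⁻ x))))
    (λ {h} _ _ → vec-ext _ _ λ u →
      trans (lookup-toH (toF h) u) (trans (lookup-toF h (f u)) (cong (lookup h) (f⁻∘f u))))

-- Eliminating a label

private
  ∑χ-downFrom-≤ : ∀ m x → m ≤ x → ∑[ j ∈ downFrom m ] χ (suc j ≤ᵇ x) ≡ m
  ∑χ-downFrom-≤ zero    x m≤x = refl
  ∑χ-downFrom-≤ (suc m) x m<x rewrite dec-true (suc m ≤? x) m<x =
    cong suc (∑χ-downFrom-≤ m x (≤-trans (n≤1+n m) m<x))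

  ∑χ-downFrom-≥ : ∀ m x → x ≤ m → ∑[ j ∈ downFrom m ] χ (suc j ≤ᵇ x) ≡ x
  ∑χ-downFrom-≥ zero    .zero z≤n = refl
  ∑χ-downFrom-≥ (suc m) x   x≤1+m with m≤n⇒m<n∨m≡n x≤1+m
  ... | inj₁ (s≤s x≤m) rewrite dec-false (suc m ≤? x) (<⇒≱ (s≤s x≤m)) = ∑χ-downFrom-≥ m x x≤m
  ... | inj₂ refl      rewrite dec-true (suc m ≤? suc m) ≤-refl = cong suc (∑χ-downFrom-≤ m (suc m) (n≤1+n m))

∑-layers : (xs : List A) (x : A → ℕ) (m : ℕ) → (∀ {a} → a ∈ xs → x a ≤ m) →
  ∑ xs x ≡ ∑[ j ∈ downFrom m ] count (λ a → suc j ≤ᵇ x a) xs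
∑-layers xs x m bounded = begin
  ∑ xs x                                             ≡⟨ ∑-cong xs (λ a∈ → sym (∑χ-downFrom-≥ m _ (bounded a∈))) ⟩
  ∑[ a ∈ xs ] ∑[ j ∈ downFrom m ] χ (suc j ≤ᵇ x a)   ≡⟨ ∑-swap xs (downFrom m) _ ⟩
  ∑[ j ∈ downFrom m ] ∑[ a ∈ xs ] χ (suc j ≤ᵇ x a)   ≡⟨ ∑-cong (downFrom m) (λ _ → sym (count≡∑χ _ xs)) ⟩
  ∑[ j ∈ downFrom m ] count (λ a → suc j ≤ᵇ x a) xs  ∎
  where open ≡-Reasoning

ite-≟-refl : ∀ {k} (ℓ : Fin k) (x y : A) → (if does (ℓ ≟F ℓ) then x else y) ≡ x
ite-≟-refl ℓ x y rewrite dec-true (ℓ ≟F ℓ) refl = refl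

ite-≟-≢ : ∀ {k} {j ℓ : Fin k} (x y : A) → ¬ j ≡ ℓ → (if does (j ≟F ℓ) then x else y) ≡ y
ite-≟-≢ {j = j} {ℓ} x y j≢ℓ rewrite dec-false (j ≟F ℓ) j≢ℓ = refl

relabel : ∀ {k} (G : LGraph k) → (Fin k → Maybe (Fin (n G))) → LGraph k
relabel G α = record { n = n G ; adj = adj G ; sym = LGraph.sym G ; irrefl = irrefl G ; ν = α }

avoiding? : ∀ {k} (S : Tolerance k) (ℓ a b : Fin k) → Dec (S a b ≡ true × ¬ a ≡ ℓ × ¬ b ≡ ℓ)
avoiding? S ℓ a b = (S a b ≟ᵇ true) ×-dec ¬? (a ≟F ℓ) ×-dec ¬? (b ≟F ℓ)

_∖_ : ∀ {k} → Tolerance k → Fin k → Tolerance k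
(S ∖ ℓ) a b = does (avoiding? S ℓ a b)

module _ {k : ℕ} (S : Tolerance k) (F : LGraph k) (ℓ : Fin k) {w : Fin (n F)} (νℓ : ν F ℓ ≡ just w)
         (G : LGraph k) where

  private
    F⁻ = removeLabel ℓ F

    G[_] : Fin (n G) → LGraph k
    G[ v ] = relabel G (ν G [ ℓ ↦ v ])

    label⁻ : ∀ j a → ν F⁻ j ≡ just a → ¬ j ≡ ℓ × ν F j ≡ just a
    label⁻ j a νa with j ≟F ℓ
    ... | yes refl = case νa of λ ()
    ... | no j≢ℓ   = j≢ℓ , νa

    pinned-hom : ∀ v h → IsHomExcept S F⁻ G h × lookup h w ≡ v → IsHomExcept (S ∖ ℓ) F G[ v ] h
    pinned-hom v h ((edges , labs) , hw≡v) = edges′ , labs′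
      where
      edges′ : PreservesEdgesExcept (S ∖ ℓ) F G[ v ] h
      edges′ u u' uu' with edges u u' uu'
      ... | inj₂ huu' = inj₂ huu'
      ... | inj₁ (a , b , Sab , νa , νb) with label⁻ a u νa | label⁻ b u' νb
      ...   | a≢ℓ , νa′ | b≢ℓ , νb′ =
        inj₁ (a , b , dec-true (avoiding? S ℓ a b) (Sab , a≢ℓ , b≢ℓ) , νa′ , νb′)
      labs′ : PreservesLabels (S ∖ ℓ) F G[ v ] h
      labs′ j a νa with j ≟F ℓ
      ... | yes refl = cong just (trans (sym hw≡v) (cong (lookup h) (just-injective (trans (sym νℓ) νa))))
      ... | no j≢ℓ   = labs j a (trans (ite-≟-≢ nothing (ν F j) j≢ℓ) νa)

    unpinned-hom : ∀ v h → IsHomExcept (S ∖ ℓ) F G[ v ] h → IsHomExcept S F⁻ G h × lookup h w ≡ v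
    unpinned-hom v h (edges , labs) =
      (edges′ , labs′) , just-injective (trans (sym (labs ℓ w νℓ)) (ite-≟-refl ℓ _ _))
      where
      edges′ : PreservesEdgesExcept S F⁻ G h
      edges′ u u' uu' with edges u u' uu'
      ... | inj₂ huu' = inj₂ huu'
      ... | inj₁ (a , b , S∖ℓab , νa , νb) with proj₁ (means-does (avoiding? S ℓ a b)) S∖ℓab
      ...   | Sab , a≢ℓ , b≢ℓ =
        inj₁ (a , b , Sab , trans (ite-≟-≢ _ _ a≢ℓ) νa , trans (ite-≟-≢ _ _ b≢ℓ) νb)
      labs′ : PreservesLabels S F⁻ G h
      labs′ j a νa with label⁻ j a νa
      ... | j≢ℓ , νa′ = trans (sym (ite-≟-≢ _ _ j≢ℓ)) (labs j a νa′)

  homExcept-removeLabel : homExcept S F⁻ G ≡ ∑[ v ∈ allFin (n G) ] homExcept (S ∖ ℓ) F G[ v ]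
  homExcept-removeLabel =
    trans (count-fibres _ (n G) (λ h → lookup h w) (allMaps (n F) (n G)))
          (∑-cong (allFin (n G)) λ {v} _ → count-cong _ _ (allMaps (n F) (n G)) λ {h} _ →
            means-unique (means-∧ (means-isHomExcept S F⁻ G h) (means-does (lookup h w ≟F v)))
                         (means-map (means-isHomExcept (S ∖ ℓ) F G[ v ] h) (unpinned-hom v h) (pinned-hom v h)))

module _ {k q : ℕ} where

  atLeastF : (ℕ → Form k q) → ℕ → Form k q
  atLeastF ψ j = ¬f (⋁< ψ j)

  layersF : Fin k → (ℕ → Form k q) → ℕ → ℕ → Form k (suc q)
  layersF ℓ ψ zero    r = constF (does (r ≟ℕ 0))
  layersF ℓ ψ (suc M) r = ⋁≤ (λ a → ∃= a ℓ (atLeastF ψ (suc M)) ∧f layersF ℓ ψ M (r ∸ a)) r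

  -- The first conjunct bounds every summand by m, so that m layers suffice.
  sumF : Fin k → (ℕ → Form k q) → ℕ → Form k (suc q)
  sumF ℓ ψ m = ¬f (∃≥ 1 ℓ (atLeastF ψ (suc m))) ∧f layersF ℓ ψ m m

module _ {k q : ℕ} (G : LGraph k) (α : Fin k → Maybe (Fin (n G))) (ℓ : Fin k)
         (x : Fin (n G) → ℕ) (ψ : ℕ → Form k q)
         (ψ-means : ∀ v j → Means (sat G (ψ j) (α [ ℓ ↦ v ])) (x v ≡ j)) where

  private
    V = allFin (n G)

    layer : ℕ → ℕ
    layer j = count (λ v → suc j ≤ᵇ x v) V

    means-atLeastF : ∀ v j → Means (sat G (atLeastF ψ j) (α [ ℓ ↦ v ])) (j ≤ x v)
    means-atLeastF v j = means-map (means-not (means-⋁< G (α [ ℓ ↦ v ]) ψ (ψ-means v) j))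
      (λ ¬x<j → ≮⇒≥ (λ x<j → ¬x<j (x v , x<j , refl)))
      (λ { j≤x (a , a<j , refl) → <⇒≱ a<j j≤x })

    witnesses-atLeastF : ∀ j → witnesses G α ℓ (atLeastF ψ (suc j)) ≡ layer j
    witnesses-atLeastF j = count-cong _ _ V λ {v} _ →
      means-unique (means-atLeastF v (suc j)) (means-does (suc j ≤? x v))

    means-layersF : ∀ M r → Means (sat G (layersF ℓ ψ M r) α) (∑ (downFrom M) layer ≡ r)
    means-layersF zero    r = means-constF G α _ (means-map (means-does (r ≟ℕ 0)) sym sym)
    means-layersF (suc M) r = means-map
      (means-⋁≤ G α _ (λ a → means-∧
        (subst (λ c → Means _ (c ≡ a)) (witnesses-atLeastF M) (means-∃= G α a ℓ (atLeastF ψ (suc M))))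
        (means-layersF M (r ∸ a))) r)
      (λ { (a , a≤r , refl , rest) → trans (cong (layer M +_) rest) (m+[n∸m]≡n a≤r) })
      (λ total → layer M , subst (layer M ≤_) total (m≤m+n (layer M) _) , refl ,
                 sym (trans (cong (_∸ layer M) (sym total)) (m+n∸m≡n (layer M) _)))

    Bounded : ℕ → Set
    Bounded m = ∀ {v} → v ∈ V → x v ≤ m

    ∑≡⇒bounded : ∀ {m} → ∑ V x ≡ m → Bounded m
    ∑≡⇒bounded {m} total {v} v∈ = subst (x v ≤_) total (summand≤∑ V v∈)
      where
      summand≤∑ : (vs : List (Fin (n G))) → v ∈ vs → x v ≤ ∑ vs x
      summand≤∑ (u ∷ vs) (here refl) = m≤m+n (x v) _
      summand≤∑ (u ∷ vs) (there v∈) = ≤-trans (summand≤∑ vs v∈) (m≤n+m _ (x u))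

    layer≡0⇒bounded : ∀ m → layer m ≡ 0 → Bounded m
    layer≡0⇒bounded m none {v} v∈ = ≮⇒≥ λ m<x →
      case trans (sym (dec-true (suc m ≤? x v) m<x)) (count≡0⇒rejected _ V none v∈) of λ ()

    bounded⇒layer≡0 : ∀ m → Bounded m → layer m ≡ 0
    bounded⇒layer≡0 m bounded =
      rejected⇒count≡0 _ V λ {v} v∈ → dec-false (suc m ≤? x v) (λ m<x → <⇒≱ m<x (bounded v∈))

    means-bounded : ∀ m → Means (sat G (¬f (∃≥ 1 ℓ (atLeastF ψ (suc m)))) α) (Bounded m)
    means-bounded m = means-map {Q = Bounded m}
      (means-not (subst (λ c → Means _ (1 ≤ c)) (witnesses-atLeastF m) (means-∃≥ G α 1 ℓ (atLeastF ψ (suc m)))))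
      (λ ¬1≤layer → layer≡0⇒bounded m (n≤0⇒n≡0 (≮⇒≥ ¬1≤layer)))
      (λ bounded 1≤layer → case subst (1 ≤_) (bounded⇒layer≡0 m bounded) 1≤layer of λ ())

  means-sumF : ∀ m → Means (sat G (sumF ℓ ψ m) α) (∑ V x ≡ m)
  means-sumF m = means-map (means-∧ (means-bounded m) (means-layersF m m))
    (λ { (bounded , layers) → trans (∑-layers V x m bounded) layers })
    (λ total → ∑≡⇒bounded total , trans (sym (∑-layers V x m (∑≡⇒bounded total))) total)

-- Products

private
  pick-sound : ∀ d {X : Fin d → Set} (g : (i : Fin d) → Maybe (X i)) {i x} →
               pick d g ≡ just (i , x) → g i ≡ just x
  pick-sound (suc d) g picked with g zero in g0
  pick-sound (suc d) g refl | just x = g0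
  ... | nothing with pick d (λ i → g (suc i)) in picked′
  pick-sound (suc d) g refl | nothing | just _ = pick-sound d (λ i → g (suc i)) picked′

  pick-complete : ∀ d {X : Fin d → Set} (g : (i : Fin d) → Maybe (X i)) i x →
                  g i ≡ just x → ∃ λ p → pick d g ≡ just p
  pick-complete (suc d) g i x gi with g zero in g0
  ... | just y = (zero , y) , refl
  pick-complete (suc d) g zero    x gi | nothing = case trans (sym g0) gi of λ ()
  pick-complete (suc d) g (suc i) x gi | nothing with pick-complete d (λ i → g (suc i)) i x gi
  ... | (j , y) , picked rewrite picked = (suc j , y) , refl

module _ {k : ℕ} (S : Tolerance k) (F : LGraph k) where

  InheritedTolerated : Fin k → Fin k → Set
  InheritedTolerated a b = Σ (Fin (n F)) λ x → Σ (Fin (n F)) λ y →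
    ν F a ≡ just x × ν F b ≡ just y × (x ≡ y ⊎ Tolerated S F x y)

  inheritedTolerated? : ∀ a b → Dec (InheritedTolerated a b)
  inheritedTolerated? a b = any? λ x → any? λ y →
    (ν F a ≟M just x) ×-dec (ν F b ≟M just y) ×-dec ((x ≟F y) ⊎-dec tolerated? S F x y)

  inherited : Tolerance k
  inherited a b = does (inheritedTolerated? a b)

module _ {k c : ℕ} {F : LGraph k} {Gs : Fin c → LGraph k} (F≅∏ : IsProductOf F Gs) where
  open Product Gs
  open Realizes F≅∏

  private
    Labelled : PV → Set
    Labelled (i , a) = ∃ λ ℓ → ν (Gs i) ℓ ≡ just a

    ≈P-labelled : ∀ {u v} → u ≈P v → u ≡ v ⊎ Labelled u × Labelled v
    ≈P-labelled ε = inj₁ refl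
    ≈P-labelled ((ℓ , νa , νb) ◅ rest) with ≈P-labelled rest
    ... | inj₁ refl           = inj₂ ((ℓ , νa) , (ℓ , νb))
    ... | inj₂ (_ , labelled) = inj₂ ((ℓ , νa) , labelled)

  label-factor⇒product : ∀ i ℓ a → ν (Gs i) ℓ ≡ just a → ν F ℓ ≡ just (f (i , a))
  label-factor⇒product i ℓ a νa with pick-complete c (λ i → ν (Gs i) ℓ) i a νa
  ... | (j , b) , picked = trans (labels ℓ) (trans (cong (Maybe.map f) picked)
        (cong just (sym (resp (i , a) (j , b) ((ℓ , νa , pick-sound c (λ i → ν (Gs i) ℓ) picked) ◅ ε)))))

  label-product⇒factor : ∀ ℓ x → ν F ℓ ≡ just x →
                         ∃ λ p → ν (Gs (proj₁ p)) ℓ ≡ just (proj₂ p) × f p ≡ x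
  label-product⇒factor ℓ x νx with map≡just⁻ f (PLab ℓ) (trans (sym (labels ℓ)) νx)
  ... | p , picked , fp≡x = p , pick-sound c (λ i → ν (Gs i) ℓ) picked , fp≡x

  labelled-factor : ∀ i a ℓ → ν F ℓ ≡ just (f (i , a)) → Labelled (i , a)
  labelled-factor i a ℓ νfa with label-product⇒factor ℓ _ νfa
  ... | p , νp , fp≡ with ≈P-labelled (reflect p (i , a) fp≡)
  ...   | inj₁ refl           = ℓ , νp
  ...   | inj₂ (_ , labelled) = labelled

  ⊆L-factor : ∀ {G} → F ⊆L G → ∀ i → Gs i ⊆L G
  ⊆L-factor F⊆G i ℓ (a , νa) = F⊆G ℓ (f (i , a) , label-factor⇒product i ℓ a νa)

  module _ (S : Tolerance k) (G : LGraph k) where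

    private
      S⁺ = inherited S F

      d : Fin c → ℕ
      d i = n (Gs i)

      value : MapFamily c d (n G) → PV → Fin (n G)
      value hs (i , a) = lookup (component hs i) a

      AllHom : MapFamily c d (n G) → Set
      AllHom hs = ∀ i → IsHomExcept S⁺ (Gs i) G (component hs i)

      value-resp : ∀ hs → AllHom hs → ∀ {u v} → u ≈P v → value hs u ≡ value hs v
      value-resp hs homs ε = refl
      value-resp hs homs {i , a} ((ℓ , νa , νb) ◅ rest) =
        trans (just-injective (trans (sym (proj₂ (homs i) ℓ a νa)) (proj₂ (homs _) ℓ _ νb))) (value-resp hs homs rest)

      f⁻ : Fin (n F) → PV
      f⁻ x = proj₁ (surj x)

      f∘f⁻ : ∀ x → f (f⁻ x) ≡ x
      f∘f⁻ x = proj₂ (surj x)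

      restrict : Vec (Fin (n G)) (n F) → MapFamily c d (n G)
      restrict h = family (λ i → tabulate (λ a → lookup h (f (i , a))))

      lookup-restrict : ∀ h i a → lookup (component (restrict h) i) a ≡ lookup h (f (i , a))
      lookup-restrict h i a =
        trans (cong (λ hᵢ → lookup hᵢ a) (component-family {c} {d} {n G} (λ i → tabulate (λ a → lookup h (f (i , a)))) i))
              (lookup∘tabulate _ a)

      glue : MapFamily c d (n G) → Vec (Fin (n G)) (n F)
      glue hs = tabulate (λ x → value hs (f⁻ x))

      lookup-glue : ∀ hs x → lookup (glue hs) x ≡ value hs (f⁻ x)
      lookup-glue hs = lookup∘tabulate (λ x → value hs (f⁻ x))

      inherited-intro : ∀ a b x y → ν F a ≡ just x → ν F b ≡ just y →
                        x ≡ y ⊎ Tolerated S F x y → S⁺ a b ≡ true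
      inherited-intro a b x y νa νb rel = dec-true (inheritedTolerated? S F a b) (x , y , νa , νb , rel)

      restrict-hom : ∀ h → IsHomExcept S F G h → AllHom (restrict h)
      restrict-hom h (edges , labs) i = edges′ , labs′
        where
        labs′ : PreservesLabels S⁺ (Gs i) G (component (restrict h) i)
        labs′ ℓ a νa =
          trans (labs ℓ (f (i , a)) (label-factor⇒product i ℓ a νa)) (cong just (sym (lookup-restrict h i a)))
        tolerate : ∀ {a b} → Labelled (i , a) → Labelled (i , b) →
                   f (i , a) ≡ f (i , b) ⊎ Tolerated S F (f (i , a)) (f (i , b)) → Tolerated S⁺ (Gs i) a b
        tolerate (ℓa , νa) (ℓb , νb) rel = ℓa , ℓb ,
          inherited-intro ℓa ℓb _ _ (label-factor⇒product i ℓa _ νa) (label-factor⇒product i ℓb _ νb) rel , νa , νb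
        edges′ : PreservesEdgesExcept S⁺ (Gs i) G (component (restrict h) i)
        edges′ a b ab with f (i , a) ≟F f (i , b)
        ... | yes fa≡fb with ≈P-labelled (reflect (i , a) (i , b) fa≡fb)
        ...   | inj₁ refl = case trans (sym (irrefl (Gs i) a)) ab of λ ()
        ...   | inj₂ (la , lb) = inj₁ (tolerate la lb (inj₁ fa≡fb))
        edges′ a b ab | no fa≢fb
          with edges (f (i , a)) (f (i , b))
                     (edge⇐ (i , a) (i , b) (((i , a) , (i , b) , ε , ε , ce i a b ab) , λ a≈b → fa≢fb (resp _ _ a≈b)))
        ... | inj₂ hab = inj₂ (subst₂ (Edge G) (sym (lookup-restrict h i a)) (sym (lookup-restrict h i b)) hab)
        ... | inj₁ tol@(ℓa , ℓb , _ , νa , νb) =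
          inj₁ (tolerate (labelled-factor i a ℓa νa) (labelled-factor i b ℓb νb) (inj₂ tol))

      glue-hom : ∀ hs → AllHom hs → IsHomExcept S F G (glue hs)
      glue-hom hs homs = edges′ , labs′
        where
        labs′ : PreservesLabels S F G (glue hs)
        labs′ ℓ x νx with label-product⇒factor ℓ x νx
        ... | p , νp , fp≡x = trans (proj₂ (homs (proj₁ p)) ℓ (proj₂ p) νp)
          (cong just (trans (value-resp hs homs (reflect p (f⁻ x) (trans fp≡x (sym (f∘f⁻ x)))))
                            (sym (lookup-glue hs x))))
        glued : ∀ {u x} → f⁻ x ≈P u → value hs u ≡ lookup (glue hs) x
        glued {x = x} ≈u = sym (trans (lookup-glue hs x) (value-resp hs homs ≈u))
        edges′ : PreservesEdgesExcept S F G (glue hs)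
        edges′ x y xy with edge⇒ (f⁻ x) (f⁻ y) (subst₂ (Edge F) (sym (f∘f⁻ x)) (sym (f∘f⁻ y)) xy)
        ... | ((i , a) , (.i , b) , a≈ , b≈ , ce .i .a .b ab) , x≉y with proj₁ (homs i) a b ab
        ...   | inj₂ hab = inj₂ (subst₂ (Edge G) (glued a≈) (glued b≈) hab)
        ...   | inj₁ (ℓa , ℓb , S⁺ab , νa , νb) with proj₁ (means-does (inheritedTolerated? S F ℓa ℓb)) S⁺ab
        ...     | x′ , y′ , νx′ , νy′ , rel = untangle rel
          where
          at : ∀ {ℓ a x′ x} → ν (Gs i) ℓ ≡ just a → ν F ℓ ≡ just x′ → f⁻ x ≈P (i , a) → x′ ≡ x
          at {x = x} νa νx′ ≈a = trans (just-injective (trans (sym νx′) (label-factor⇒product i _ _ νa)))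
                                       (trans (sym (resp _ _ ≈a)) (f∘f⁻ x))
          untangle : x′ ≡ y′ ⊎ Tolerated S F x′ y′ →
                     Tolerated S F x y ⊎ Edge G (lookup (glue hs) x) (lookup (glue hs) y)
          untangle (inj₁ x′≡y′) = ⊥-elim (x≉y (reflect (f⁻ x) (f⁻ y) (begin
            f (f⁻ x)  ≡⟨ f∘f⁻ x ⟩
            x         ≡⟨ sym (at νa νx′ a≈) ⟩
            x′        ≡⟨ x′≡y′ ⟩
            y′        ≡⟨ at νb νy′ b≈ ⟩
            y         ≡⟨ sym (f∘f⁻ y) ⟩
            f (f⁻ y)  ∎)))
            where open ≡-Reasoning
          untangle (inj₂ tol) = inj₁ (subst₂ (Tolerated S F) (at νa νx′ a≈) (at νb νy′ b≈) tol)

      means-AllHom : ∀ hs → Means (∀-components (λ i hᵢ → does (isHomExcept? S⁺ (Gs i) G hᵢ)) hs) (AllHom hs)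
      means-AllHom hs = means-map (means-∀-components _ hs)
        (λ ok i → accepted⇒hom S⁺ (Gs i) G (component hs i) (ok i))
        (λ homs i → hom⇒accepted S⁺ (Gs i) G (component hs i) (homs i))
        where
        means-∀-components : ∀ {c d} (P : (i : Fin c) → Vec (Fin (n G)) (d i) → Bool) (hs : MapFamily c d (n G)) →
          Means (∀-components P hs) (∀ i → P i (component hs i) ≡ true)
        means-∀-components {zero}  P tt       = (λ _ ()) , (λ _ → refl)
        means-∀-components {suc c} P (h , hs) =
          means-map (means-∧ {P zero h} means-true (means-∀-components (λ i → P (suc i)) hs))
            (λ { (ok , oks) zero → ok ; (ok , oks) (suc i) → oks i }) (λ oks → oks zero , (λ i → oks (suc i)))

    homExcept-product : homExcept S F G ≡ ∏ c (λ i → homExcept S⁺ (Gs i) G)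
    homExcept-product = trans
      (count-bijection _ _ (allMaps (n F) (n G)) (allMapFamilies c d (n G)) (allMaps-unique _ _) (allMapFamilies-unique _ _ _)
        restrict glue
        (λ {h} _ ok → ∈-allMapFamilies _ ,
                      proj₂ (means-AllHom (restrict h)) (restrict-hom h (accepted⇒hom S F G h ok)))
        (λ {hs} _ ok → ∈-allMaps _ , hom⇒accepted S F G (glue hs) (glue-hom hs (proj₁ (means-AllHom hs) ok)))
        (λ {h} _ _ → vec-ext _ _ λ x →
          trans (lookup-glue (restrict h) x) (trans (lookup-restrict h _ _) (cong (lookup h) (f∘f⁻ x))))
        (λ {hs} _ ok → family-ext _ _ λ i → vec-ext _ _ λ a →
          trans (lookup-restrict (glue hs) i a) (trans (lookup-glue hs (f (i , a)))
            (value-resp hs (proj₁ (means-AllHom hs) ok) (reflect (f⁻ (f (i , a))) (i , a) (f∘f⁻ _))))))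
      (count-allMapFamilies c d (n G) (λ i hᵢ → does (isHomExcept? S⁺ (Gs i) G hᵢ)))

private
  factors-≤ : ∀ a b {m} → a * b ≡ suc m → a ≤ suc m × b ≤ suc m
  factors-≤ (suc a) zero    ab≡ = case trans (sym (*-zeroʳ (suc a))) ab≡ of λ ()
  factors-≤ (suc a) (suc b) ab≡ =
    subst (suc a ≤_) ab≡ (m≤m*n (suc a) (suc b)) , subst (suc b ≤_) ab≡ (m≤n*m (suc b) (suc a))

module _ {k q : ℕ} where

  productF : (c : ℕ) → (Fin c → ℕ → Form k q) → ℕ → Form k q
  productF zero    ψ m       = constF (does (m ≟ℕ 1))
  productF (suc c) ψ zero    = ψ zero 0 ∨f productF c (λ i → ψ (suc i)) 0
  productF (suc c) ψ (suc m) = ⋁≤ (λ a → ⋁≤ (λ b →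
    constF (does (a * b ≟ℕ suc m)) ∧f (ψ zero a ∧f productF c (λ i → ψ (suc i)) b)) (suc m)) (suc m)

module _ {k q : ℕ} (G : LGraph k) (α : Fin k → Maybe (Fin (n G))) where

  means-productF : ∀ c (ψ : Fin c → ℕ → Form k q) (x : Fin c → ℕ) →
    (∀ i j → Means (sat G (ψ i j) α) (x i ≡ j)) → ∀ m → Means (sat G (productF c ψ m) α) (∏ c x ≡ m)
  means-productF zero    ψ x ψ-means m = means-constF G α _ (means-map (means-does (m ≟ℕ 1)) sym sym)
  means-productF (suc c) ψ x ψ-means zero = means-map
    (means-∨ (ψ-means zero 0) (means-productF c (λ i → ψ (suc i)) (λ i → x (suc i)) (λ i → ψ-means (suc i)) 0))
    (λ { (inj₁ x₀≡0) → cong (_* ∏ c (λ i → x (suc i))) x₀≡0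
       ; (inj₂ rest≡0) → trans (cong (x zero *_) rest≡0) (*-zeroʳ (x zero)) })
    (m*n≡0⇒m≡0∨n≡0 (x zero))
  means-productF (suc c) ψ x ψ-means (suc m) = means-map
    (means-⋁≤ G α _ (λ a → means-⋁≤ G α _ (λ b →
       means-∧ (means-constF G α _ (means-does (a * b ≟ℕ suc m)))
               (means-∧ (ψ-means zero a)
                        (means-productF c (λ i → ψ (suc i)) (λ i → x (suc i)) (λ i → ψ-means (suc i)) b)))
       (suc m)) (suc m))
    (λ { (a , _ , b , _ , ab≡ , refl , refl) → ab≡ })
    (λ total → let (x₀≤ , rest≤) = factors-≤ (x zero) _ total in
      x zero , x₀≤ , ∏ c (λ i → x (suc i)) , rest≤ , total , refl , refl)

-- Fully labelled graphs

module _ {k q : ℕ} where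

  χF : Form k q → ℕ → Form k q
  χF φ zero          = ¬f φ
  χF φ (suc zero)    = φ
  χF φ (suc (suc m)) = ⊥f

module _ {k q : ℕ} (G : LGraph k) (α : Fin k → Maybe (Fin (n G))) where

  means-χF : ∀ (φ : Form k q) m → Means (sat G (χF φ m) α) (χ (sat G φ α) ≡ m)
  means-χF φ zero with sat G φ α
  ... | true  = (λ ()) , (λ ())
  ... | false = (λ _ → refl) , (λ _ → refl)
  means-χF φ (suc zero) with sat G φ α
  ... | true  = (λ _ → refl) , (λ _ → refl)
  ... | false = (λ ()) , (λ ())
  means-χF φ (suc (suc m)) with sat G φ α
  ... | true  = (λ ()) , (λ ())
  ... | false = (λ ()) , (λ ())

  sat-eq : ∀ {i j x y} → α i ≡ just x → α j ≡ just y → sat {q = q} G (eq i j) α ≡ does (x ≟F y)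
  sat-eq {i} {j} αi αj rewrite αi | αj = refl

  sat-E : ∀ {i j x y} → α i ≡ just x → α j ≡ just y → sat {q = q} G (E i j) α ≡ adj G x y
  sat-E {i} {j} αi αj rewrite αi | αj = refl

module _ {k : ℕ} (S : Tolerance k) (F : LGraph k) (full : FullyLabelled F) where

  private
    name : Fin (n F) → Fin k
    name u = proj₁ (full u)

  module _ {q : ℕ} where

    labelClause : Maybe (Fin (n F)) → Fin k → Form k q
    labelClause nothing  ℓ = ⊤f
    labelClause (just a) ℓ = eq ℓ (name a)

    edgeClause : Fin (n F) → Fin (n F) → Form k q
    edgeClause u v = if adj F u v ∧ not (does (tolerated? S F u v)) then E (name u) (name v) else ⊤f

    consistentF : Form k q
    consistentF = ⋀ (λ u → ⋀ (λ v → edgeClause u v)) ∧f ⋀ (λ ℓ → labelClause (ν F ℓ) ℓ)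

  module _ (G : LGraph k) (F⊆G : F ⊆L G) where

    private
      image : Fin (n F) → Fin (n G)
      image u = proj₁ (F⊆G (name u) (u , proj₂ (full u)))

      ν-name : ∀ u → ν G (name u) ≡ just (image u)
      ν-name u = proj₂ (F⊆G (name u) (u , proj₂ (full u)))

      h₀ : Vec (Fin (n G)) (n F)
      h₀ = tabulate image

      h₀-image : ∀ u → lookup h₀ u ≡ image u
      h₀-image = lookup∘tabulate image

      means-labelClause : ∀ {q} ℓ → Means (sat {q = q} G (labelClause (ν F ℓ) ℓ) (ν G))
                                          (∀ a → ν F ℓ ≡ just a → ν G ℓ ≡ just (lookup h₀ a))
      means-labelClause {q} ℓ with ν F ℓ in νℓ
      ... | nothing = (λ _ _ ()) , (λ _ → refl)
      ... | just a with F⊆G ℓ (a , νℓ)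
      ...   | x , νGℓ = means-subst (sym (sat-eq {q = q} G (ν G) νGℓ (ν-name a)))
        (means-map (means-does (x ≟F image a))
          (λ { x≡ .a refl → trans νGℓ (cong just (trans x≡ (sym (h₀-image a)))) })
          (λ labs → trans (just-injective (trans (sym νGℓ) (labs a refl))) (h₀-image a)))

      means-edgeClause : ∀ {q} u v → Means (sat {q = q} G (edgeClause u v) (ν G))
        (Edge F u v → Tolerated S F u v ⊎ Edge G (lookup h₀ u) (lookup h₀ v))
      means-edgeClause {q} u v with adj F u v | tolerated? S F u v
      ... | false | _       = (λ _ ()) , (λ _ → refl)
      ... | true  | yes tol = (λ _ _ → inj₁ tol) , (λ _ → refl)
      ... | true  | no ¬tol = means-subst (sym (sat-E {q = q} G (ν G) (ν-name u) (ν-name v)))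
        (means-map means-true
          (λ huv _ → inj₂ (subst₂ (Edge G) (sym (h₀-image u)) (sym (h₀-image v)) huv))
          (λ edge → [ (λ tol → ⊥-elim (¬tol tol)) , subst₂ (Edge G) (h₀-image u) (h₀-image v) ]′ (edge refl)))

      hom-unique : ∀ h → IsHomExcept S F G h → h ≡ h₀
      hom-unique h (_ , labs) = vec-ext h h₀ λ u →
        trans (just-injective (trans (sym (labs (name u) u (proj₂ (full u)))) (ν-name u))) (sym (h₀-image u))

    means-consistentF : ∀ {q} → Means (sat {q = q} G consistentF (ν G)) (IsHomExcept S F G h₀)
    means-consistentF = means-∧
      (means-⋀ G (ν G) (λ u → ⋀ (edgeClause u)) λ u → means-⋀ G (ν G) (edgeClause u) (means-edgeClause u))
      (means-⋀ G (ν G) (λ ℓ → labelClause (ν F ℓ) ℓ) means-labelClause)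

    homExcept-fullyLabelled : ∀ {q} → homExcept S F G ≡ χ (sat {q = q} G consistentF (ν G))
    homExcept-fullyLabelled {q} = trans
      (count-bijection (λ h → does (isHomExcept? S F G h)) (λ _ → sat {q = q} G consistentF (ν G))
        (allMaps (n F) (n G)) (tt ∷ []) (allMaps-unique _ _) ([] ∷ []) (λ _ → tt) (λ _ → h₀)
        (λ {h} _ ok → here refl ,
                      proj₂ means-consistentF (subst (IsHomExcept S F G) (unique h ok) (accepted⇒hom S F G h ok)))
        (λ _ ok → ∈-allMaps h₀ , hom⇒accepted S F G h₀ (proj₁ means-consistentF ok))
        (λ {h} _ ok → sym (unique h ok))
        (λ { {tt} _ _ → refl }))
      (trans (count-∷ _ tt []) (+-identityʳ _))
      where
      unique : ∀ h → does (isHomExcept? S F G h) ≡ true → h ≡ h₀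
      unique h ok = hom-unique h (accepted⇒hom S F G h ok)

-- Definability of homomorphism counts

sat-relabel : ∀ {k q} (G : LGraph k) β (φ : Form k q) α → sat (relabel G β) φ α ≡ sat G φ α
sat-relabel G β ⊤f α = refl
sat-relabel G β (eq i j) α with α i | α j
... | just u  | just v  = refl
... | just u  | nothing = refl
... | nothing | _       = refl
sat-relabel G β (E i j) α with α i | α j
... | just u  | just v  = refl
... | just u  | nothing = refl
... | nothing | _       = refl
sat-relabel G β (¬f φ)     α = cong not (sat-relabel G β φ α)
sat-relabel G β (φ ∧f ψ)   α = cong₂ _∧_ (sat-relabel G β φ α) (sat-relabel G β ψ α)
sat-relabel G β (∃≥ t i φ) α = cong (t ≤ᵇ_) (count-cong _ _ (allFin (n G)) (λ _ → sat-relabel G β φ _))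

Definable : (k q : ℕ) → Tolerance k → LGraph k → Set
Definable k q S F = ∀ m → Σ (Form k q) λ φ → ∀ G → F ⊆L G → Means (sat G φ (ν G)) (homExcept S F G ≡ m)

definable-fullyLabelled : ∀ {k q} (S : Tolerance k) (F : LGraph k) → FullyLabelled F → Definable k q S F
definable-fullyLabelled S F full m = χF (consistentF S F full) m , λ G F⊆G →
  means-trans (homExcept-fullyLabelled S F full G F⊆G) (means-χF G (ν G) (consistentF S F full) m)

definable-removeLabel : ∀ {k q} (S : Tolerance k) {F : LGraph k} (F' : LGraph k) (ℓ : Fin k) {w : Fin (n F')} →
  ν F' ℓ ≡ just w → F ≅ removeLabel ℓ F' → Definable k q (S ∖ ℓ) F' → Definable k (suc q) S F
definable-removeLabel {k} {q} S {F} F' ℓ νℓ F≅ definable m = sumF ℓ ψ m , λ G F⊆G →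
  means-trans (count-decomposition G) (means-sumF G (ν G) ℓ (x G) ψ (ψ-means G F⊆G) m)
  where
  open Realizes F≅ using (f; labels)
  ψ : ℕ → Form k q
  ψ j = proj₁ (definable j)
  G[_↦_] : (G : LGraph k) → Fin (n G) → LGraph k
  G[ G ↦ v ] = relabel G (ν G [ ℓ ↦ v ])
  x : (G : LGraph k) → Fin (n G) → ℕ
  x G v = homExcept (S ∖ ℓ) F' G[ G ↦ v ]
  count-decomposition : ∀ G → homExcept S F G ≡ ∑ (allFin (n G)) (x G)
  count-decomposition G = trans (homExcept-≅ S {F} {removeLabel ℓ F'} F≅ G) (homExcept-removeLabel S F' ℓ νℓ G)
  F'⊆G[↦] : ∀ {G} → F ⊆L G → ∀ v → F' ⊆L G[ G ↦ v ]
  F'⊆G[↦] {G} F⊆G v j (a , νa) with j ≟F ℓ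
  ... | yes refl = v , refl
  ... | no j≢ℓ   = F⊆G j (f a , trans (labels j) (cong (Maybe.map f) (trans (ite-≟-≢ nothing (ν F' j) j≢ℓ) νa)))
  ψ-means : ∀ G → F ⊆L G → ∀ v j → Means (sat G (ψ j) (ν G [ ℓ ↦ v ])) (x G v ≡ j)
  ψ-means G F⊆G v j = means-subst (sat-relabel G (ν G [ ℓ ↦ v ]) (ψ j) (ν G [ ℓ ↦ v ]))
                                  (proj₂ (definable j) G[ G ↦ v ] (F'⊆G[↦] {G} F⊆G v))

definable-product : ∀ {k q c} (S : Tolerance k) {F : LGraph k} {Gs : Fin c → LGraph k} → IsProductOf F Gs →
  (∀ i → Definable k q (inherited S F) (Gs i)) → Definable k q S F
definable-product {c = c} S {F} {Gs} F≅∏ definable m = productF c ψ m , λ G F⊆G →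
  means-trans (homExcept-product F≅∏ S G) (means-productF G (ν G) c ψ (λ i → homExcept (inherited S F) (Gs i) G)
    (λ i j → proj₂ (definable i j) G (⊆L-factor {F = F} {Gs} F≅∏ {G} F⊆G i)) m)
  where
  ψ = λ i j → proj₁ (definable i j)

definable : ∀ {k q} {F : LGraph k} → CT q F → ∀ S → Definable k q S F
definable (leaf {G = F} full)            S = definable-fullyLabelled S F full
definable (elim F' ℓ (w , νℓ) ct F≅)     S = definable-removeLabel S F' ℓ νℓ F≅ (definable ct (S ∖ ℓ))
definable (prod {G = F} c _ Gs cts F≅∏)  S = definable-product S F≅∏ (λ i → definable (cts i) (inherited S F))

lemma22 : {k q : ℕ} (F : LGraph k) → 𝓛 k q F → (m : ℕ) →
    Σ (C k q) λ φ → (G : LGraph k) → F ⊆L G → (G ⊨ φ) ⇔ (hom F G ≡ m)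
lemma22 F F∈𝓛 m = proj₁ (definable F∈𝓛 noTolerance m) , λ G F⊆G →
  let (⊨⇒ , ⇒⊨) = means-trans (hom≡homExcept F G) (proj₂ (definable F∈𝓛 noTolerance m) G F⊆G)
  in mk⇔ ⊨⇒ ⇒⊨
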